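{- Let $a, n$ and $m\ge 3$ be positive integers with $n\ge a2^m$. Then, modulo $2^m$, $$S(n,a2^m-1)\equiv \begin{cases} a2^{m-1}\binom{\frac{n}{2}-a2^{m-2}-1}{a2^{m-2}-1} & \text{if } 2\mid n,\\[2mm] a2^{m-1}\binom{\frac{n+1}{2}-a2^{m-2}-2}{a2^{m-2}-1}+\binom{\frac{n+1}{2}-a2^{m-2}-1}{a2^{m-2}-1} & \text{if } 2\nmid n.\end{cases}$$
   Context: $S(n,k)$ denotes the Stirling number of the second kind (the number of partitions of an $n$-element set into exactly $k$ nonempty blocks). -}

module Defs where

open import Data.Nat using (ℕ; zero; suc; _+_; _*_)

S : ℕ → ℕ → ℕ
S zero    zero    = 1
S zero    (suc k) = 0
S (suc n) zero    = 0
S (suc n) (suc k) = suc k * S n (suc k) + S n k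

open import Data.Integer as ℤ using (ℤ)
open import Data.Integer.Divisibility using () renaming (_∣_ to _∣ℤ_)

_≡_[mod_] : ℕ → ℕ → ℕ → Set
x ≡ y [mod M ] = ℤ.+ M ∣ℤ (ℤ.+ x ℤ.- ℤ.+ y)

module Submission where

-- Σₙ S(n + K, K) xⁿ = 1 / ∏_{i=1}^{K} (1 - i x).  Modulo 8p, for p a power of two,
-- ∏_{i=1}^{8p} (1 - i x) ≡ (1 - x²)^{2p} (1 + 4p (x + x²)): for p = 1 this is a finite
-- computation, and passing from N to 2N squares the product modulo 2N, because
-- (1 - (i + N) x)(1 - i x) is (1 - (i + N/2) x)² up to (N/2)² x², and a product of N
-- consecutive factors 1 - j x depends on its starting point only modulo N.  By the same
-- periodicity ∏_{i=1}^{a 2^m} (1 - i x) ≡ (1 - x²)^H (1 + C (x + x²)) modulo 2^m, with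
-- H = a 2^(m-2) and C = a 2^(m-1), and the last factor 1 - a 2^m x is ≡ 1.  As
-- 1 + C (x + x²) is its own inverse modulo 2^m, the Stirling series for K = a 2^m - 1 is
-- ≡ (1 + C (x + x²)) / (1 - x²)^H, whose coefficients are the binomial expressions stated.


module PowerSeries where

  open import Data.Nat as ℕ using (ℕ; zero; suc)
  import Data.Nat.Properties as ℕ
  import Data.Nat.Divisibility as ℕ
  open import Data.Nat.Combinatorics using (_C_; nCn≡1; nCk+nC[k+1]≡[n+1]C[k+1])
  open import Data.Nat.Tactic.RingSolver using () renaming (solve-∀ to ℕ-solve-∀)
  open import Data.Integer using (ℤ; +_; _+_; _*_; _-_; -_; 0ℤ; 1ℤ; -1ℤ)
  open import Data.Integer.Properties
    using (*-zeroʳ; *-identityˡ; *-distribˡ-+; +-identityˡ; +-identityʳ; +-inverseʳ; *-comm; pos-+; pos-*)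
  open import Data.Integer.Divisibility.Signed
    using (_∣_; _∣?_; divides; quotient; ∣m∣n⇒∣m+n; ∣n⇒∣m*n; ∣m⇒∣m*n; ∣m⇒∣-m; ∣ᵤ⇒∣)
  open import Data.Integer.Tactic.RingSolver using (solve-∀)
  open import Data.List using (List; []; _∷_)
  open import Data.List.Relation.Unary.All using (All; []; _∷_; all?)
  open import Data.Product using (_×_; _,_; proj₁; proj₂)
  open import Data.Unit using (tt)
  open import Defs using (S)
  open import Function using (_∘_)
  open import Relation.Binary.Bundles using (Setoid)
  open import Relation.Binary.PropositionalEquality
    using (_≡_; _≗_; refl; sym; trans; cong; cong₂; subst; module ≡-Reasoning)
  import Relation.Binary.Reasoning.Setoid as SetoidReasoning
  open import Relation.Nullary.Decidable using (toWitness)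

  Series : Set
  Series = ℕ → ℤ

  shift : Series → Series
  shift f zero    = 0ℤ
  shift f (suc n) = f n

  δ : Series
  δ zero    = 1ℤ
  δ (suc n) = 0ℤ

  infixl 6 _⊕_
  infixr 7 _⊙_
  infixl 8 _⊗_

  -- Integer polynomials in the shift x, kept as syntax so that their algebra can be proved by
  -- induction; ⟦ o ⟧ f is the product o(x) f(x) of power series.
  data Op : Set where
    I X       : Op
    _⊕_ _⊗_   : Op → Op → Op
    _⊙_       : ℤ → Op → Op

  ⟦_⟧ : Op → Series → Series
  ⟦ I ⟧      f n = f n
  ⟦ X ⟧      f n = shift f n
  ⟦ o ⊕ o′ ⟧ f n = ⟦ o ⟧ f n + ⟦ o′ ⟧ f n
  ⟦ c ⊙ o ⟧  f n = c * ⟦ o ⟧ f n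
  ⟦ o ⊗ o′ ⟧ f n = ⟦ o ⟧ (⟦ o′ ⟧ f) n

  shift-cong : ∀ {f g} → f ≗ g → shift f ≗ shift g
  shift-cong f≗g zero    = refl
  shift-cong f≗g (suc n) = f≗g n

  ⟦⟧-cong : ∀ o {f g} → f ≗ g → ⟦ o ⟧ f ≗ ⟦ o ⟧ g
  ⟦⟧-cong I        f≗g n = f≗g n
  ⟦⟧-cong X        f≗g n = shift-cong f≗g n
  ⟦⟧-cong (o ⊕ o′) f≗g n = cong₂ _+_ (⟦⟧-cong o f≗g n) (⟦⟧-cong o′ f≗g n)
  ⟦⟧-cong (c ⊙ o)  f≗g n = cong (c *_) (⟦⟧-cong o f≗g n)
  ⟦⟧-cong (o ⊗ o′) f≗g n = ⟦⟧-cong o (⟦⟧-cong o′ f≗g) n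

  ⟦⟧-+ : ∀ o f g n → ⟦ o ⟧ (λ k → f k + g k) n ≡ ⟦ o ⟧ f n + ⟦ o ⟧ g n
  ⟦⟧-+ I        f g n       = refl
  ⟦⟧-+ X        f g zero    = refl
  ⟦⟧-+ X        f g (suc n) = refl
  ⟦⟧-+ (o ⊕ o′) f g n       = trans (cong₂ _+_ (⟦⟧-+ o f g n) (⟦⟧-+ o′ f g n))
                                  (swap (⟦ o ⟧ f n) (⟦ o ⟧ g n) (⟦ o′ ⟧ f n) (⟦ o′ ⟧ g n))
    where
    swap : ∀ a b c d → a + b + (c + d) ≡ a + c + (b + d)
    swap = solve-∀
  ⟦⟧-+ (c ⊙ o)  f g n       = trans (cong (c *_) (⟦⟧-+ o f g n)) (*-distribˡ-+ c _ _)
  ⟦⟧-+ (o ⊗ o′) f g n       =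
    trans (⟦⟧-cong o (⟦⟧-+ o′ f g) n) (⟦⟧-+ o (⟦ o′ ⟧ f) (⟦ o′ ⟧ g) n)

  ⟦⟧-* : ∀ o c f n → ⟦ o ⟧ (λ k → c * f k) n ≡ c * ⟦ o ⟧ f n
  ⟦⟧-* I        c f n       = refl
  ⟦⟧-* X        c f zero    = sym (*-zeroʳ c)
  ⟦⟧-* X        c f (suc n) = refl
  ⟦⟧-* (o ⊕ o′) c f n       = trans (cong₂ _+_ (⟦⟧-* o c f n) (⟦⟧-* o′ c f n)) (sym (*-distribˡ-+ c _ _))
  ⟦⟧-* (d ⊙ o)  c f n       = trans (cong (d *_) (⟦⟧-* o c f n)) (swap d c (⟦ o ⟧ f n))
    where
    swap : ∀ a b x → a * (b * x) ≡ b * (a * x)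
    swap = solve-∀
  ⟦⟧-* (o ⊗ o′) c f n       = trans (⟦⟧-cong o (⟦⟧-* o′ c f) n) (⟦⟧-* o c (⟦ o′ ⟧ f) n)

  ⟦⟧-affine : ∀ o g c h n → ⟦ o ⟧ (λ k → g k + c * h k) n ≡ ⟦ o ⟧ g n + c * ⟦ o ⟧ h n
  ⟦⟧-affine o g c h n = trans (⟦⟧-+ o g (λ k → c * h k) n) (cong (_+_ (⟦ o ⟧ g n)) (⟦⟧-* o c h n))

  ⟦⟧-shift : ∀ o f n → ⟦ o ⟧ (shift f) n ≡ shift (⟦ o ⟧ f) n
  ⟦⟧-shift I        f n       = refl
  ⟦⟧-shift X        f n       = refl
  ⟦⟧-shift (o ⊕ o′) f zero    = cong₂ _+_ (⟦⟧-shift o f zero) (⟦⟧-shift o′ f zero)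
  ⟦⟧-shift (o ⊕ o′) f (suc n) = cong₂ _+_ (⟦⟧-shift o f (suc n)) (⟦⟧-shift o′ f (suc n))
  ⟦⟧-shift (c ⊙ o)  f zero    = trans (cong (c *_) (⟦⟧-shift o f zero)) (*-zeroʳ c)
  ⟦⟧-shift (c ⊙ o)  f (suc n) = cong (c *_) (⟦⟧-shift o f (suc n))
  ⟦⟧-shift (o ⊗ o′) f n       = trans (⟦⟧-cong o (⟦⟧-shift o′ f) n) (⟦⟧-shift o (⟦ o′ ⟧ f) n)

  ⟦⟧-comm : ∀ o o′ f n → ⟦ o ⟧ (⟦ o′ ⟧ f) n ≡ ⟦ o′ ⟧ (⟦ o ⟧ f) n
  ⟦⟧-comm I          o′ f n = refl
  ⟦⟧-comm X          o′ f n = sym (⟦⟧-shift o′ f n)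
  ⟦⟧-comm (o₁ ⊕ o₂)  o′ f n =
    trans (cong₂ _+_ (⟦⟧-comm o₁ o′ f n) (⟦⟧-comm o₂ o′ f n))
      (sym (⟦⟧-+ o′ (⟦ o₁ ⟧ f) (⟦ o₂ ⟧ f) n))
  ⟦⟧-comm (c ⊙ o)    o′ f n = trans (cong (c *_) (⟦⟧-comm o o′ f n)) (sym (⟦⟧-* o′ c (⟦ o ⟧ f) n))
  ⟦⟧-comm (o₁ ⊗ o₂)  o′ f n =
    trans (⟦⟧-cong o₁ (⟦⟧-comm o₂ o′ f) n) (⟦⟧-comm o₁ o′ (⟦ o₂ ⟧ f) n)

  infix 4 _≈[_]_ _≈ᴼ[_]_

  record _≈[_]_ (f : Series) (M : ℤ) (g : Series) : Set where
    constructor mk≈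
    field at : ∀ n → M ∣ f n - g n
  open _≈[_]_ public

  ∣-refl-diff : ∀ {M} x y → x ≡ y → M ∣ x - y
  ∣-refl-diff x _ refl = divides 0ℤ (+-inverseʳ x)

  ∣-sym-diff : ∀ {M} x y → M ∣ x - y → M ∣ y - x
  ∣-sym-diff x y M∣x-y = subst (_ ∣_) (negate x y) (∣m⇒∣-m M∣x-y)
    where
    negate : ∀ x y → - (x - y) ≡ y - x
    negate = solve-∀

  ∣-trans-diff : ∀ {M} x y z → M ∣ x - y → M ∣ y - z → M ∣ x - z
  ∣-trans-diff x y z M∣x-y M∣y-z = subst (_ ∣_) (telescope x y z) (∣m∣n⇒∣m+n M∣x-y M∣y-z)
    where
    telescope : ∀ x y z → (x - y) + (y - z) ≡ x - z
    telescope = solve-∀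

  ∣-+-diff : ∀ {M} a a′ b b′ → M ∣ a - a′ → M ∣ b - b′ → M ∣ (a + b) - (a′ + b′)
  ∣-+-diff a a′ b b′ M∣a-a′ M∣b-b′ =
    subst (_ ∣_) (regroup a a′ b b′) (∣m∣n⇒∣m+n M∣a-a′ M∣b-b′)
    where
    regroup : ∀ a a′ b b′ → (a - a′) + (b - b′) ≡ (a + b) - (a′ + b′)
    regroup = solve-∀

  ≗⇒≈ : ∀ {M f g} → f ≗ g → f ≈[ M ] g
  ≗⇒≈ {f = f} {g} f≗g = mk≈ λ n → ∣-refl-diff (f n) (g n) (f≗g n)

  ≈-sym : ∀ {M f g} → f ≈[ M ] g → g ≈[ M ] f
  ≈-sym {f = f} {g} f≈g = mk≈ λ n → ∣-sym-diff (f n) (g n) (at f≈g n)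

  ≈-trans : ∀ {M f g h} → f ≈[ M ] g → g ≈[ M ] h → f ≈[ M ] h
  ≈-trans {f = f} {g} {h} f≈g g≈h = mk≈ λ n → ∣-trans-diff (f n) (g n) (h n) (at f≈g n) (at g≈h n)

  ≈-setoid : ℤ → Setoid _ _
  ≈-setoid M = record
    { Carrier       = Series
    ; _≈_           = _≈[ M ]_
    ; isEquivalence = record { refl = ≗⇒≈ λ n → refl ; sym = ≈-sym ; trans = ≈-trans }
    }

  module ≈-Reasoning (M : ℤ) = SetoidReasoning (≈-setoid M)

  ⟦⟧-≈ : ∀ o {M f g} → f ≈[ M ] g → ⟦ o ⟧ f ≈[ M ] ⟦ o ⟧ g
  ⟦⟧-≈ I        f≈g = f≈g
  ⟦⟧-≈ X        f≈g = mk≈ λ where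
    zero    → divides 0ℤ refl
    (suc n) → at f≈g n
  ⟦⟧-≈ (o ⊕ o′) {f = f} {g} f≈g = mk≈ λ n →
    ∣-+-diff (⟦ o ⟧ f n) (⟦ o ⟧ g n) (⟦ o′ ⟧ f n) (⟦ o′ ⟧ g n)
      (at (⟦⟧-≈ o f≈g) n) (at (⟦⟧-≈ o′ f≈g) n)
  ⟦⟧-≈ (c ⊙ o)  {f = f} {g} f≈g = mk≈ λ n →
    subst (_ ∣_) (factor c (⟦ o ⟧ f n) (⟦ o ⟧ g n)) (∣n⇒∣m*n c (at (⟦⟧-≈ o f≈g) n))
    where
    factor : ∀ c a a′ → c * (a - a′) ≡ c * a - c * a′
    factor = solve-∀
  ⟦⟧-≈ (o ⊗ o′) f≈g = ⟦⟧-≈ o (⟦⟧-≈ o′ f≈g)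

  record _≈ᴼ[_]_ (o : Op) (M : ℤ) (o′ : Op) : Set where
    constructor mk≈ᴼ
    field apply : ∀ f → ⟦ o ⟧ f ≈[ M ] ⟦ o′ ⟧ f
  open _≈ᴼ[_]_ public

  ≗ᴼ⇒≈ᴼ : ∀ {M o o′} → (∀ f → ⟦ o ⟧ f ≗ ⟦ o′ ⟧ f) → o ≈ᴼ[ M ] o′
  ≗ᴼ⇒≈ᴼ o≗o′ = mk≈ᴼ λ f → ≗⇒≈ (o≗o′ f)

  ≈ᴼ-setoid : ℤ → Setoid _ _
  ≈ᴼ-setoid M = record
    { Carrier       = Op
    ; _≈_           = _≈ᴼ[ M ]_
    ; isEquivalence = record
      { refl  = ≗ᴼ⇒≈ᴼ λ f n → refl
      ; sym   = λ o≈o′ → mk≈ᴼ λ f → ≈-sym (apply o≈o′ f)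
      ; trans = λ o≈o′ o′≈o″ → mk≈ᴼ λ f → ≈-trans (apply o≈o′ f) (apply o′≈o″ f)
      }
    }

  module ≈ᴼ-Reasoning (M : ℤ) = SetoidReasoning (≈ᴼ-setoid M)

  ≈ᴼ-refl : ∀ {M o} → o ≈ᴼ[ M ] o
  ≈ᴼ-refl {M} = Setoid.refl (≈ᴼ-setoid M)

  ≈ᴼ-sym : ∀ {M o o′} → o ≈ᴼ[ M ] o′ → o′ ≈ᴼ[ M ] o
  ≈ᴼ-sym {M} = Setoid.sym (≈ᴼ-setoid M)

  ≈ᴼ-trans : ∀ {M o o′ o″} → o ≈ᴼ[ M ] o′ → o′ ≈ᴼ[ M ] o″ → o ≈ᴼ[ M ] o″
  ≈ᴼ-trans {M} = Setoid.trans (≈ᴼ-setoid M)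

  ⊗-cong : ∀ {M o₁ o₁′ o₂ o₂′} → o₁ ≈ᴼ[ M ] o₁′ → o₂ ≈ᴼ[ M ] o₂′ →
           o₁ ⊗ o₂ ≈ᴼ[ M ] o₁′ ⊗ o₂′
  ⊗-cong {o₁ = o₁} {o₂′ = o₂′} o₁≈ o₂≈ =
    mk≈ᴼ λ f → ≈-trans (⟦⟧-≈ o₁ (apply o₂≈ f)) (apply o₁≈ (⟦ o₂′ ⟧ f))

  ⊕-cong : ∀ {M o₁ o₁′ o₂ o₂′} → o₁ ≈ᴼ[ M ] o₁′ → o₂ ≈ᴼ[ M ] o₂′ →
           o₁ ⊕ o₂ ≈ᴼ[ M ] o₁′ ⊕ o₂′
  ⊕-cong {o₁ = o₁} {o₁′} {o₂} {o₂′} o₁≈ o₂≈ = mk≈ᴼ λ f → mk≈ λ n →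
    ∣-+-diff (⟦ o₁ ⟧ f n) (⟦ o₁′ ⟧ f n) (⟦ o₂ ⟧ f n) (⟦ o₂′ ⟧ f n)
      (at (apply o₁≈ f) n) (at (apply o₂≈ f) n)

  ⊙-cong : ∀ {M c d} o → M ∣ c - d → c ⊙ o ≈ᴼ[ M ] d ⊙ o
  ⊙-cong {c = c} {d} o M∣c-d = mk≈ᴼ λ f → mk≈ λ n →
    subst (_ ∣_) (factor c d (⟦ o ⟧ f n)) (∣m⇒∣m*n (⟦ o ⟧ f n) M∣c-d)
    where
    factor : ∀ c d x → (c - d) * x ≡ c * x - d * x
    factor = solve-∀

  ⊗-comm : ∀ {M} o o′ → o ⊗ o′ ≈ᴼ[ M ] o′ ⊗ o
  ⊗-comm o o′ = ≗ᴼ⇒≈ᴼ (⟦⟧-comm o o′)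

  ⊗-assoc : ∀ {M} o₁ o₂ o₃ → (o₁ ⊗ o₂) ⊗ o₃ ≈ᴼ[ M ] o₁ ⊗ (o₂ ⊗ o₃)
  ⊗-assoc o₁ o₂ o₃ = ≗ᴼ⇒≈ᴼ λ f n → refl

  ⊗-interchange : ∀ {M} o₁ o₂ o₃ o₄ →
                  (o₁ ⊗ o₂) ⊗ (o₃ ⊗ o₄) ≈ᴼ[ M ] (o₁ ⊗ o₃) ⊗ (o₂ ⊗ o₄)
  ⊗-interchange o₁ o₂ o₃ o₄ = ≗ᴼ⇒≈ᴼ λ f → ⟦⟧-cong o₁ (⟦⟧-comm o₂ o₃ (⟦ o₄ ⟧ f))

  ≡+quotient : ∀ {M x y} (M∣x-y : M ∣ x - y) → x ≡ y + M * quotient M∣x-y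
  ≡+quotient {M} {x} {y} (divides q x-y≡qM) = begin
    x             ≡⟨ split x y ⟩
    y + (x - y)   ≡⟨ cong (_+_ y) x-y≡qM ⟩
    y + q * M     ≡⟨ cong (_+_ y) (*-comm q M) ⟩
    y + M * q     ∎
    where
    open ≡-Reasoning
    split : ∀ x y → x ≡ y + (x - y)
    split = solve-∀

  -- Writing o g = o′ g + M r g, both o (o f) and o′ (o′ f) differ from o (o′ f) = o′ (o f)
  -- by M times o (r f), o′ (r f), and these two differ by M (r (r f)).
  ⊗-square-cong : ∀ {M N o o′} → N ∣ M + M → N ∣ M * M → o ≈ᴼ[ M ] o′ →
                  o ⊗ o ≈ᴼ[ N ] o′ ⊗ o′
  ⊗-square-cong {M} {N} {o} {o′} N∣2M N∣M² o≈o′ = mk≈ᴼ λ f → mk≈ λ n →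
    subst (N ∣_) (sym (difference f n))
      (∣m∣n⇒∣m+n (∣m⇒∣m*n (⟦ o′ ⟧ (r f) n) N∣2M) (∣m⇒∣m*n (r (r f) n) N∣M²))
    where
    open ≡-Reasoning
    r : Series → Series
    r g k = quotient (at (apply o≈o′ g) k)
    split : ∀ g → ⟦ o ⟧ g ≗ λ k → ⟦ o′ ⟧ g k + M * r g k
    split g k = ≡+quotient (at (apply o≈o′ g) k)
    expand : ∀ o″ g n → ⟦ o″ ⟧ (⟦ o ⟧ g) n ≡ ⟦ o″ ⟧ (⟦ o′ ⟧ g) n + M * ⟦ o″ ⟧ (r g) n
    expand o″ g n = trans (⟦⟧-cong o″ (split g) n) (⟦⟧-affine o″ (⟦ o′ ⟧ g) M (r g) n)
    difference : ∀ f n → ⟦ o ⟧ (⟦ o ⟧ f) n - ⟦ o′ ⟧ (⟦ o′ ⟧ f) n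
                       ≡ (M + M) * ⟦ o′ ⟧ (r f) n + (M * M) * r (r f) n
    difference f n = begin
      ⟦ o ⟧ (⟦ o ⟧ f) n - D
        ≡⟨ cong (_- D) (expand o f n) ⟩
      ⟦ o ⟧ (⟦ o′ ⟧ f) n + M * ⟦ o ⟧ (r f) n - D
        ≡⟨ cong₂ (λ u v → u + M * v - D) (trans (⟦⟧-comm o o′ f n) (expand o′ f n)) (split (r f) n) ⟩
      D + M * ⟦ o′ ⟧ (r f) n + M * (⟦ o′ ⟧ (r f) n + M * r (r f) n) - D
        ≡⟨ collect D M (⟦ o′ ⟧ (r f) n) (r (r f) n) ⟩
      (M + M) * ⟦ o′ ⟧ (r f) n + (M * M) * r (r f) n ∎
      where
      D = ⟦ o′ ⟧ (⟦ o′ ⟧ f) n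
      collect : ∀ D M u s → D + M * u + M * (u + M * s) - D ≡ (M + M) * u + (M * M) * s
      collect = solve-∀

  pos-∣ : ∀ q {m n} → n ≡ q ℕ.* m → + m ∣ + n
  pos-∣ q n≡qm = ∣ᵤ⇒∣ (ℕ.divides q n≡qm)

  ⊗-square-cong-even : ∀ h {o o′} → o ≈ᴼ[ + (2 ℕ.* h) ] o′ →
                       o ⊗ o ≈ᴼ[ + (2 ℕ.* (2 ℕ.* h)) ] o′ ⊗ o′
  ⊗-square-cong-even h = ⊗-square-cong
    (subst (+ (4h) ∣_) (pos-+ (2 ℕ.* h) (2 ℕ.* h)) (pos-∣ 1 (twice (2 ℕ.* h))))
    (subst (+ (4h) ∣_) (pos-* (2 ℕ.* h) (2 ℕ.* h)) (pos-∣ h (square h)))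
    where
    4h = 2 ℕ.* (2 ℕ.* h)
    twice : ∀ N → N ℕ.+ N ≡ 1 ℕ.* (2 ℕ.* N)
    twice = ℕ-solve-∀
    square : ∀ h → 2 ℕ.* h ℕ.* (2 ℕ.* h) ≡ h ℕ.* (2 ℕ.* (2 ℕ.* h))
    square = ℕ-solve-∀

  ≡⇒≈ᴼ : ∀ {M o o′} → o ≡ o′ → o ≈ᴼ[ M ] o′
  ≡⇒≈ᴼ refl = ≈ᴼ-refl

  prod : (ℕ → Op) → ℕ → Op
  prod F zero    = I
  prod F (suc n) = F n ⊗ prod F n

  infixr 9 _^ᴼ_
  _^ᴼ_ : Op → ℕ → Op
  o ^ᴼ k = prod (λ _ → o) k

  prod-cong : ∀ {M F G} → (∀ i → F i ≈ᴼ[ M ] G i) → ∀ n → prod F n ≈ᴼ[ M ] prod G n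
  prod-cong F≈G zero    = ≈ᴼ-refl
  prod-cong F≈G (suc n) = ⊗-cong (F≈G n) (prod-cong F≈G n)

  prod-+ : ∀ {M} F k n → prod F (k ℕ.+ n) ≈ᴼ[ M ] prod (λ i → F (i ℕ.+ n)) k ⊗ prod F n
  prod-+ F zero    n = ≗ᴼ⇒≈ᴼ λ f m → refl
  prod-+ {M} F (suc k) n = begin
    F (k ℕ.+ n) ⊗ prod F (k ℕ.+ n)                                ≈⟨ ⊗-cong ≈ᴼ-refl (prod-+ F k n) ⟩
    F (k ℕ.+ n) ⊗ (prod (λ i → F (i ℕ.+ n)) k ⊗ prod F n)         ≈⟨ ⊗-assoc _ _ _ ⟨
    prod (λ i → F (i ℕ.+ n)) (suc k) ⊗ prod F n                   ∎
    where open ≈ᴼ-Reasoning M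

  prod-suc : ∀ {M} F n → prod F (suc n) ≈ᴼ[ M ] prod (F ∘ suc) n ⊗ F 0
  prod-suc F zero    = ≗ᴼ⇒≈ᴼ λ f m → refl
  prod-suc {M} F (suc n) = begin
    F (suc n) ⊗ prod F (suc n)                ≈⟨ ⊗-cong ≈ᴼ-refl (prod-suc F n) ⟩
    F (suc n) ⊗ (prod (F ∘ suc) n ⊗ F 0)      ≈⟨ ⊗-assoc _ _ _ ⟨
    prod (F ∘ suc) (suc n) ⊗ F 0              ∎
    where open ≈ᴼ-Reasoning M

  prod-⊗ : ∀ {M} F G n → prod (λ i → F i ⊗ G i) n ≈ᴼ[ M ] prod F n ⊗ prod G n
  prod-⊗ F G zero    = ≗ᴼ⇒≈ᴼ λ f m → refl
  prod-⊗ {M} F G (suc n) = begin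
    (F n ⊗ G n) ⊗ prod (λ i → F i ⊗ G i) n    ≈⟨ ⊗-cong ≈ᴼ-refl (prod-⊗ F G n) ⟩
    (F n ⊗ G n) ⊗ (prod F n ⊗ prod G n)       ≈⟨ ⊗-interchange _ _ _ _ ⟩
    prod F (suc n) ⊗ prod G (suc n)           ∎
    where open ≈ᴼ-Reasoning M

  ^ᴼ-+ : ∀ {M} o k n → o ^ᴼ (k ℕ.+ n) ≈ᴼ[ M ] o ^ᴼ k ⊗ o ^ᴼ n
  ^ᴼ-+ o = prod-+ (λ _ → o)

  infix 10 1-_·x
  1-_·x : ℤ → Op
  1- c ·x = I ⊕ (- c) ⊙ X

  1-·x-cong : ∀ {M c d} → M ∣ c - d → 1- c ·x ≈ᴼ[ M ] 1- d ·x
  1-·x-cong {c = c} {d} M∣c-d = ⊕-cong ≈ᴼ-refl (⊙-cong X (subst (_ ∣_) (negate c d) (∣m⇒∣-m M∣c-d)))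
    where
    negate : ∀ c d → - (c - d) ≡ - c - - d
    negate = solve-∀

  1-0·x : ∀ {M} → 1- 0ℤ ·x ≈ᴼ[ M ] I
  1-0·x = ≗ᴼ⇒≈ᴼ λ f n → +-identityʳ (f n)

  ⟦1-·x⊗1-·x⟧ : ∀ a b f n →
    ⟦ 1- a ·x ⊗ 1- b ·x ⟧ f n ≡ f n - (a + b) * shift f n + a * b * shift (shift f) n
  ⟦1-·x⊗1-·x⟧ a b f zero    = expand (f 0) a b
    where
    expand : ∀ x a b → x + - b * 0ℤ + - a * 0ℤ ≡ x - (a + b) * 0ℤ + a * b * 0ℤ
    expand = solve-∀
  ⟦1-·x⊗1-·x⟧ a b f (suc n) = expand (f (suc n)) (f n) (shift f n) a b
    where
    expand : ∀ x y z a b → x + - b * y + - a * (y + - b * z) ≡ x - (a + b) * y + a * b * z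
    expand = solve-∀

  -- (1 - (b + 2h) x) (1 - b x) = (1 - (b + h) x)² - h² x²
  1-·x-pairing : ∀ {M} b h → M ∣ h * h → 1- (b + h + h) ·x ⊗ 1- b ·x ≈ᴼ[ M ] 1- (b + h) ·x ⊗ 1- (b + h) ·x
  1-·x-pairing b h M∣h² = mk≈ᴼ λ f → mk≈ λ n →
    subst (_ ∣_)
      (trans (difference (f n) (shift f n) (shift (shift f) n) b h)
        (sym (cong₂ _-_ (⟦1-·x⊗1-·x⟧ (b + h + h) b f n) (⟦1-·x⊗1-·x⟧ (b + h) (b + h) f n))))
      (∣m⇒∣-m (∣m⇒∣m*n (shift (shift f) n) M∣h²))
    where
    difference : ∀ x y z b h → - (h * h * z)
               ≡ (x - (b + h + h + b) * y + (b + h + h) * b * z) - (x - (b + h + (b + h)) * y + (b + h) * (b + h) * z)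
    difference = solve-∀

  ∏[1-ix] : ℕ → Op
  ∏[1-ix] = prod λ i → 1- + suc i ·x

  ∏[1-ix]-from : ℕ → ℕ → Op
  ∏[1-ix]-from s = prod λ i → 1- + suc (i ℕ.+ s) ·x

  ∏[1-ix]-from-suc : ∀ s N → ∏[1-ix]-from (suc s) N ≈ᴼ[ + N ] ∏[1-ix]-from s N
  ∏[1-ix]-from-suc s zero    = ≈ᴼ-refl
  ∏[1-ix]-from-suc s (suc N) = begin
    1- + suc (N ℕ.+ suc s) ·x ⊗ ∏[1-ix]-from (suc s) N   ≈⟨ ⊗-cong (1-·x-cong period) ≈ᴼ-refl ⟩
    1- + suc s ·x ⊗ ∏[1-ix]-from (suc s) N               ≈⟨ ⊗-comm _ _ ⟩
    ∏[1-ix]-from (suc s) N ⊗ 1- + suc s ·x               ≈⟨ ⊗-cong (prod-cong reindex N) ≈ᴼ-refl ⟩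
    prod (λ i → 1- + suc (suc i ℕ.+ s) ·x) N ⊗ 1- + suc s ·x ≈⟨ prod-suc _ N ⟨
    ∏[1-ix]-from s (suc N)                               ∎
    where
    open ≈ᴼ-Reasoning (+ suc N)
    period : + suc N ∣ + suc (N ℕ.+ suc s) - + suc s
    period = divides 1ℤ (trans (cong (_- + suc s) (pos-+ (suc N) (suc s))) (cancel (+ suc N) (+ suc s)))
      where
      cancel : ∀ x y → x + y - y ≡ 1ℤ * x
      cancel = solve-∀
    reindex : ∀ i → 1- + suc (i ℕ.+ suc s) ·x ≈ᴼ[ + suc N ] 1- + suc (suc i ℕ.+ s) ·x
    reindex i = ≡⇒≈ᴼ (cong (λ j → 1- + suc j ·x) (ℕ.+-suc i s))

  ∏[1-ix]-from-periodic : ∀ s N → ∏[1-ix]-from s N ≈ᴼ[ + N ] ∏[1-ix] N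
  ∏[1-ix]-from-periodic zero    N =
    prod-cong (λ i → ≡⇒≈ᴼ (cong (λ j → 1- + suc j ·x) (ℕ.+-identityʳ i))) N
  ∏[1-ix]-from-periodic (suc s) N = ≈ᴼ-trans (∏[1-ix]-from-suc s N) (∏[1-ix]-from-periodic s N)

  ∏[1-ix]-multiple : ∀ k N → ∏[1-ix] (k ℕ.* N) ≈ᴼ[ + N ] ∏[1-ix] N ^ᴼ k
  ∏[1-ix]-multiple zero    N = ≈ᴼ-refl
  ∏[1-ix]-multiple (suc k) N = begin
    ∏[1-ix] (N ℕ.+ k ℕ.* N)
      ≈⟨ prod-+ _ N (k ℕ.* N) ⟩
    ∏[1-ix]-from (k ℕ.* N) N ⊗ ∏[1-ix] (k ℕ.* N)
      ≈⟨ ⊗-cong (∏[1-ix]-from-periodic (k ℕ.* N) N) (∏[1-ix]-multiple k N) ⟩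
    ∏[1-ix] N ⊗ ∏[1-ix] N ^ᴼ k
      ∎
    where open ≈ᴼ-Reasoning (+ N)

  ∏[1-ix]-drop-last : ∀ {M K} → M ∣ + suc K → ∏[1-ix] (suc K) ≈ᴼ[ M ] ∏[1-ix] K
  ∏[1-ix]-drop-last {M} {K} M∣1+K = begin
    1- + suc K ·x ⊗ ∏[1-ix] K    ≈⟨ ⊗-cong (1-·x-cong {d = 0ℤ} M∣1+K-0) ≈ᴼ-refl ⟩
    1- 0ℤ ·x ⊗ ∏[1-ix] K         ≈⟨ ⊗-cong 1-0·x ≈ᴼ-refl ⟩
    I ⊗ ∏[1-ix] K                ≈⟨ ≗ᴼ⇒≈ᴼ (λ f n → refl) ⟩
    ∏[1-ix] K                    ∎
    where
    open ≈ᴼ-Reasoning M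
    M∣1+K-0 : M ∣ + suc K - 0ℤ
    M∣1+K-0 = subst (M ∣_) (sym (+-identityʳ (+ suc K))) M∣1+K

  -- Pair the factor i + N with i and write it as the square of the factor i + h, up to h² x².
  ∏[1-ix]-double : ∀ t → let h = 2 ℕ.* (2 ℕ.* t); N = 2 ℕ.* h in
    ∏[1-ix] (2 ℕ.* N) ≈ᴼ[ + (2 ℕ.* N) ] ∏[1-ix] N ⊗ ∏[1-ix] N
  ∏[1-ix]-double t = begin
    ∏[1-ix] (2 ℕ.* N)
      ≈⟨ ≡⇒≈ᴼ (cong ∏[1-ix] (cong (N ℕ.+_) (ℕ.+-identityʳ N))) ⟩
    ∏[1-ix] (N ℕ.+ N)
      ≈⟨ prod-+ _ N N ⟩
    ∏[1-ix]-from N N ⊗ ∏[1-ix] N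
      ≈⟨ prod-⊗ _ _ N ⟨
    prod (λ i → 1- + suc (i ℕ.+ N) ·x ⊗ 1- + suc i ·x) N
      ≈⟨ prod-cong pair N ⟩
    prod (λ i → 1- + suc (i ℕ.+ h) ·x ⊗ 1- + suc (i ℕ.+ h) ·x) N
      ≈⟨ prod-⊗ _ _ N ⟩
    ∏[1-ix]-from h N ⊗ ∏[1-ix]-from h N
      ≈⟨ ⊗-square-cong-even h (∏[1-ix]-from-periodic h N) ⟩
    ∏[1-ix] N ⊗ ∏[1-ix] N
      ∎
    where
    h = 2 ℕ.* (2 ℕ.* t)
    N = 2 ℕ.* h
    open ≈ᴼ-Reasoning (+ (2 ℕ.* N))
    2N∣h*h : + (2 ℕ.* N) ∣ + h * + h
    2N∣h*h = subst (+ (2 ℕ.* N) ∣_) (pos-* h h) (pos-∣ t (identity t))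
      where
      identity : ∀ t → 2 ℕ.* (2 ℕ.* t) ℕ.* (2 ℕ.* (2 ℕ.* t)) ≡ t ℕ.* (2 ℕ.* (2 ℕ.* (2 ℕ.* (2 ℕ.* t))))
      identity = ℕ-solve-∀
    pair : ∀ i → 1- + suc (i ℕ.+ N) ·x ⊗ 1- + suc i ·x
                 ≈ᴼ[ + (2 ℕ.* N) ] 1- + suc (i ℕ.+ h) ·x ⊗ 1- + suc (i ℕ.+ h) ·x
    pair i = begin
      1- + suc (i ℕ.+ N) ·x ⊗ 1- b ·x      ≈⟨ ≡⇒≈ᴼ (cong (λ c → 1- c ·x ⊗ 1- b ·x) far) ⟩
      1- (b + + h + + h) ·x ⊗ 1- b ·x      ≈⟨ 1-·x-pairing b (+ h) 2N∣h*h ⟩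
      1- (b + + h) ·x ⊗ 1- (b + + h) ·x    ≈⟨ ≡⇒≈ᴼ (cong (λ c → 1- c ·x ⊗ 1- c ·x) near) ⟨
      1- + suc (i ℕ.+ h) ·x ⊗ 1- + suc (i ℕ.+ h) ·x ∎
      where
      b = + suc i
      near : + suc (i ℕ.+ h) ≡ b + + h
      near = pos-+ (suc i) h
      far : + suc (i ℕ.+ N) ≡ b + + h + + h
      far = trans (cong (λ j → + suc j) (identity i h))
              (trans (pos-+ (suc i ℕ.+ h) h) (cong (_+ + h) near))
        where
        identity : ∀ i h → i ℕ.+ 2 ℕ.* h ≡ i ℕ.+ h ℕ.+ h
        identity = ℕ-solve-∀

  1-x² : Op
  1-x² = I ⊕ -1ℤ ⊙ X ⊗ X

  x+x² : Op
  x+x² = X ⊕ X ⊗ X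

  infix 10 1+_·[x+x²]
  1+_·[x+x²] : ℤ → Op
  1+ c ·[x+x²] = I ⊕ c ⊙ x+x²

  1+·[x+x²]-cong : ∀ {M c d} → M ∣ c - d → 1+ c ·[x+x²] ≈ᴼ[ M ] 1+ d ·[x+x²]
  1+·[x+x²]-cong M∣c-d = ⊕-cong ≈ᴼ-refl (⊙-cong x+x² M∣c-d)

  1+0·[x+x²] : ∀ {M} → 1+ 0ℤ ·[x+x²] ≈ᴼ[ M ] I
  1+0·[x+x²] = ≗ᴼ⇒≈ᴼ λ f n → +-identityʳ (f n)

  1+·[x+x²]-⊗ : ∀ {M} c d → M ∣ c * d → 1+ c ·[x+x²] ⊗ 1+ d ·[x+x²] ≈ᴼ[ M ] 1+ (c + d) ·[x+x²]
  1+·[x+x²]-⊗ c d M∣cd = mk≈ᴼ λ f → mk≈ λ n →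
    subst (_ ∣_)
      (trans (expand (f n) (⟦ x+x² ⟧ f n) (⟦ x+x² ⟧ (⟦ x+x² ⟧ f) n) c d)
        (cong (λ u → f n + d * ⟦ x+x² ⟧ f n + c * u - (f n + (c + d) * ⟦ x+x² ⟧ f n))
          (sym (⟦⟧-affine x+x² f d (⟦ x+x² ⟧ f) n))))
      (∣m⇒∣m*n (⟦ x+x² ⟧ (⟦ x+x² ⟧ f) n) M∣cd)
    where
    expand : ∀ x u v c d → c * d * v ≡ x + d * u + c * (u + d * v) - (x + (c + d) * u)
    expand = solve-∀

  Q : ℕ → ℤ → Op
  Q e c = 1-x² ^ᴼ e ⊗ 1+ c ·[x+x²]

  Q-⊗ : ∀ {M} i j c d → M ∣ c * d → Q i c ⊗ Q j d ≈ᴼ[ M ] Q (i ℕ.+ j) (c + d)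
  Q-⊗ {M} i j c d M∣cd = begin
    Q i c ⊗ Q j d
      ≈⟨ ⊗-interchange _ _ _ _ ⟩
    (1-x² ^ᴼ i ⊗ 1-x² ^ᴼ j) ⊗ (1+ c ·[x+x²] ⊗ 1+ d ·[x+x²])
      ≈⟨ ⊗-cong (≈ᴼ-sym (^ᴼ-+ 1-x² i j)) (1+·[x+x²]-⊗ c d M∣cd) ⟩
    Q (i ℕ.+ j) (c + d)
      ∎
    where open ≈ᴼ-Reasoning M

  Q-^ᴼ : ∀ {M} e c → M ∣ c * c → ∀ a → Q e c ^ᴼ a ≈ᴼ[ M ] Q (a ℕ.* e) (+ a * c)
  Q-^ᴼ {M} e c M∣c² zero    = begin
    I                        ≈⟨ 1+0·[x+x²] ⟨
    1+ 0ℤ ·[x+x²]            ≈⟨ ≗ᴼ⇒≈ᴼ (λ f n → refl) ⟩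
    Q 0 (+ 0 * c)            ∎
    where open ≈ᴼ-Reasoning M
  Q-^ᴼ {M} e c M∣c² (suc a) = begin
    Q e c ⊗ Q e c ^ᴼ a                     ≈⟨ ⊗-cong ≈ᴼ-refl (Q-^ᴼ e c M∣c² a) ⟩
    Q e c ⊗ Q (a ℕ.* e) (+ a * c)          ≈⟨ Q-⊗ e (a ℕ.* e) c (+ a * c) M∣c*ac ⟩
    Q (suc a ℕ.* e) (c + + a * c)          ≈⟨ ≡⇒≈ᴼ (cong (Q (suc a ℕ.* e)) (sym [1+a]c≡c+ac)) ⟩
    Q (suc a ℕ.* e) (+ suc a * c)          ∎
    where
    open ≈ᴼ-Reasoning M
    M∣c*ac : M ∣ c * (+ a * c)
    M∣c*ac = subst (M ∣_) (rearrange (+ a) c) (∣n⇒∣m*n (+ a) M∣c²)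
      where
      rearrange : ∀ a c → a * (c * c) ≡ c * (a * c)
      rearrange = solve-∀
    [1+a]c≡c+ac : + suc a * c ≡ c + + a * c
    [1+a]c≡c+ac = trans (cong (_* c) (pos-+ 1 a)) (distrib (+ a) c)
      where
      distrib : ∀ a c → (1ℤ + a) * c ≡ c + a * c
      distrib = solve-∀

  infixl 6 _+ᶜ_
  infixl 7 _⊗ᶜ_
  infixr 8 _·ᶜ_

  ⟦_⟧ᶜ : List ℤ → Series → Series
  ⟦ []    ⟧ᶜ f n = 0ℤ
  ⟦ a ∷ p ⟧ᶜ f n = a * f n + shift (⟦ p ⟧ᶜ f) n

  _+ᶜ_ : List ℤ → List ℤ → List ℤ
  []      +ᶜ q       = q
  (a ∷ p) +ᶜ []      = a ∷ p
  (a ∷ p) +ᶜ (b ∷ q) = a + b ∷ p +ᶜ q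

  _·ᶜ_ : ℤ → List ℤ → List ℤ
  c ·ᶜ []      = []
  c ·ᶜ (a ∷ p) = c * a ∷ c ·ᶜ p

  _⊗ᶜ_ : List ℤ → List ℤ → List ℤ
  []      ⊗ᶜ q = []
  (a ∷ p) ⊗ᶜ q = a ·ᶜ q +ᶜ (0ℤ ∷ p ⊗ᶜ q)

  coefficients : Op → List ℤ
  coefficients I        = 1ℤ ∷ []
  coefficients X        = 0ℤ ∷ 1ℤ ∷ []
  coefficients (o ⊕ o′) = coefficients o +ᶜ coefficients o′
  coefficients (c ⊙ o)  = c ·ᶜ coefficients o
  coefficients (o ⊗ o′) = coefficients o ⊗ᶜ coefficients o′

  shift-⟦[]⟧ᶜ : ∀ f n → shift (⟦ [] ⟧ᶜ f) n ≡ 0ℤ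
  shift-⟦[]⟧ᶜ f zero    = refl
  shift-⟦[]⟧ᶜ f (suc n) = refl

  ⟦+ᶜ⟧ : ∀ p q f n → ⟦ p +ᶜ q ⟧ᶜ f n ≡ ⟦ p ⟧ᶜ f n + ⟦ q ⟧ᶜ f n
  ⟦+ᶜ⟧ []      q       f n = sym (+-identityˡ _)
  ⟦+ᶜ⟧ (a ∷ p) []      f n = sym (+-identityʳ _)
  ⟦+ᶜ⟧ (a ∷ p) (b ∷ q) f n =
    trans (cong (_+_ ((a + b) * f n))
            (trans (shift-cong (⟦+ᶜ⟧ p q f) n) (⟦⟧-+ X (⟦ p ⟧ᶜ f) (⟦ q ⟧ᶜ f) n)))
      (regroup a b (f n) (shift (⟦ p ⟧ᶜ f) n) (shift (⟦ q ⟧ᶜ f) n))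
    where
    regroup : ∀ a b x u v → (a + b) * x + (u + v) ≡ a * x + u + (b * x + v)
    regroup = solve-∀

  ⟦·ᶜ⟧ : ∀ c p f n → ⟦ c ·ᶜ p ⟧ᶜ f n ≡ c * ⟦ p ⟧ᶜ f n
  ⟦·ᶜ⟧ c []      f n = sym (*-zeroʳ c)
  ⟦·ᶜ⟧ c (a ∷ p) f n =
    trans (cong (_+_ (c * a * f n)) (trans (shift-cong (⟦·ᶜ⟧ c p f) n) (⟦⟧-* X c (⟦ p ⟧ᶜ f) n)))
      (factor c a (f n) (shift (⟦ p ⟧ᶜ f) n))
    where
    factor : ∀ c a x u → c * a * x + c * u ≡ c * (a * x + u)
    factor = solve-∀

  ⟦⊗ᶜ⟧ : ∀ p q f n → ⟦ p ⊗ᶜ q ⟧ᶜ f n ≡ ⟦ p ⟧ᶜ (⟦ q ⟧ᶜ f) n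
  ⟦⊗ᶜ⟧ []      q f n = refl
  ⟦⊗ᶜ⟧ (a ∷ p) q f n =
    trans (⟦+ᶜ⟧ (a ·ᶜ q) (0ℤ ∷ p ⊗ᶜ q) f n)
      (cong₂ _+_ (⟦·ᶜ⟧ a q f n) (trans (+-identityˡ _) (shift-cong (⟦⊗ᶜ⟧ p q f) n)))

  ⟦⟧ᶜ-cong : ∀ p {f g} → f ≗ g → ⟦ p ⟧ᶜ f ≗ ⟦ p ⟧ᶜ g
  ⟦⟧ᶜ-cong []      f≗g n = refl
  ⟦⟧ᶜ-cong (a ∷ p) f≗g n = cong₂ (λ u v → a * u + v) (f≗g n) (shift-cong (⟦⟧ᶜ-cong p f≗g) n)

  ⟦1∷[]⟧ᶜ : ∀ f n → ⟦ 1ℤ ∷ [] ⟧ᶜ f n ≡ f n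
  ⟦1∷[]⟧ᶜ f n = trans (cong (_+_ (1ℤ * f n)) (shift-⟦[]⟧ᶜ f n)) (trans (+-identityʳ _) (*-identityˡ (f n)))

  coefficients-sound : ∀ o f n → ⟦ o ⟧ f n ≡ ⟦ coefficients o ⟧ᶜ f n
  coefficients-sound I        f n       = sym (⟦1∷[]⟧ᶜ f n)
  coefficients-sound X        f zero    = refl
  coefficients-sound X        f (suc n) = sym (trans (+-identityˡ _) (⟦1∷[]⟧ᶜ f n))
  coefficients-sound (o ⊕ o′) f n       =
    trans (cong₂ _+_ (coefficients-sound o f n) (coefficients-sound o′ f n)) (sym (⟦+ᶜ⟧ (coefficients o) _ f n))
  coefficients-sound (c ⊙ o)  f n       =
    trans (cong (c *_) (coefficients-sound o f n)) (sym (⟦·ᶜ⟧ c (coefficients o) f n))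
  coefficients-sound (o ⊗ o′) f n       =
    trans (coefficients-sound o (⟦ o′ ⟧ f) n)
      (trans (⟦⟧ᶜ-cong (coefficients o) (coefficients-sound o′ f) n) (sym (⟦⊗ᶜ⟧ (coefficients o) _ f n)))

  ⟦⟧ᶜ-divisible : ∀ {M} p → All (M ∣_) p → ∀ f n → M ∣ ⟦ p ⟧ᶜ f n
  ⟦⟧ᶜ-divisible []      []             f n       = divides 0ℤ refl
  ⟦⟧ᶜ-divisible (a ∷ p) (M∣a ∷ M∣p) f n       =
    ∣m∣n⇒∣m+n (∣m⇒∣m*n (f n) M∣a) (shifted n)
    where
    shifted : ∀ n → _ ∣ shift (⟦ p ⟧ᶜ f) n
    shifted zero    = divides 0ℤ refl
    shifted (suc n) = ⟦⟧ᶜ-divisible p M∣p f n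

  ≈ᴼ-by-coefficients : ∀ {M} o o′ → All (M ∣_) (coefficients (o ⊕ -1ℤ ⊙ o′)) → o ≈ᴼ[ M ] o′
  ≈ᴼ-by-coefficients o o′ M∣coefficients = mk≈ᴼ λ f → mk≈ λ n →
    subst (_ ∣_) (trans (sym (coefficients-sound (o ⊕ -1ℤ ⊙ o′) f n)) (minus (⟦ o ⟧ f n) (⟦ o′ ⟧ f n)))
      (⟦⟧ᶜ-divisible _ M∣coefficients f n)
    where
    minus : ∀ x y → x + -1ℤ * y ≡ x - y
    minus = solve-∀

  ∏[1-ix]-8 : ∏[1-ix] 8 ≈ᴼ[ + 8 ] Q 2 (+ 4)
  ∏[1-ix]-8 = ≈ᴼ-by-coefficients (∏[1-ix] 8) (Q 2 (+ 4)) (toWitness {a? = all? (+ 8 ∣?_) _} tt)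

  ∏[1-ix]-2^ : ∀ k → ∏[1-ix] (2 ℕ.^ (3 ℕ.+ k))
                     ≈ᴼ[ + (2 ℕ.^ (3 ℕ.+ k)) ] Q (2 ℕ.^ (1 ℕ.+ k)) (+ (2 ℕ.^ (2 ℕ.+ k)))
  ∏[1-ix]-2^ zero    = ∏[1-ix]-8
  ∏[1-ix]-2^ (suc k) = begin
    ∏[1-ix] (2 ℕ.* N)                  ≈⟨ ∏[1-ix]-double (2 ℕ.^ k) ⟩
    ∏[1-ix] N ⊗ ∏[1-ix] N              ≈⟨ ⊗-square-cong-even (2 ℕ.^ (2 ℕ.+ k)) (∏[1-ix]-2^ k) ⟩
    Q e (+ c) ⊗ Q e (+ c)              ≈⟨ Q-⊗ e e (+ c) (+ c) 2N∣c*c ⟩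
    Q (e ℕ.+ e) (+ c + + c)            ≈⟨ ≡⇒≈ᴼ (cong₂ Q (twice e) (trans (sym (pos-+ c c)) (cong +_ (twice c)))) ⟩
    Q (2 ℕ.* e) (+ (2 ℕ.* c))          ∎
    where
    N = 2 ℕ.^ (3 ℕ.+ k)
    e = 2 ℕ.^ (1 ℕ.+ k)
    c = 2 ℕ.^ (2 ℕ.+ k)
    open ≈ᴼ-Reasoning (+ (2 ℕ.* N))
    twice : ∀ n → n ℕ.+ n ≡ 2 ℕ.* n
    twice n = cong (n ℕ.+_) (sym (ℕ.+-identityʳ n))
    2N∣c*c : + (2 ℕ.* N) ∣ + c * + c
    2N∣c*c = subst (+ (2 ℕ.* N) ∣_) (pos-* c c) (pos-∣ (2 ℕ.^ k) (square (2 ℕ.^ k)))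
      where
      square : ∀ p → 2 ℕ.* (2 ℕ.* p) ℕ.* (2 ℕ.* (2 ℕ.* p)) ≡ p ℕ.* (2 ℕ.* (2 ℕ.* (2 ℕ.* (2 ℕ.* p))))
      square = ℕ-solve-∀

  S-vanishes : ∀ {n k} → n ℕ.< k → S n k ≡ 0
  S-vanishes {zero}  {suc k} _           = refl
  S-vanishes {suc n} {suc k} (ℕ.s≤s n<k) =
    trans (cong₂ (λ u v → suc k ℕ.* u ℕ.+ v) (S-vanishes (ℕ.m<n⇒m<1+n n<k)) (S-vanishes n<k))
      (trans (ℕ.+-identityʳ (suc k ℕ.* 0)) (ℕ.*-zeroʳ (suc k)))

  stirlingSeries : ℕ → Series
  stirlingSeries k N = + S (N ℕ.+ k) k

  1-·x-stirlingSeries : ∀ k → ⟦ 1- + suc k ·x ⟧ (stirlingSeries (suc k)) ≗ stirlingSeries k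
  1-·x-stirlingSeries k zero    =
    trans (cong (_+_ (+ S (suc k) (suc k))) (*-zeroʳ (- + suc k)))
      (trans (+-identityʳ _) (cong +_ (trans (cong (λ u → suc k ℕ.* u ℕ.+ S k k) (S-vanishes (ℕ.n<1+n k)))
                                              (cong (ℕ._+ S k k) (ℕ.*-zeroʳ (suc k))))))
  1-·x-stirlingSeries k (suc N) = begin
    + (suc k ℕ.* A ℕ.+ B) + - + suc k * + A    ≡⟨ cong (λ u → u + - + suc k * + A) (pos-+ (suc k ℕ.* A) B) ⟩
    + (suc k ℕ.* A) + + B + - + suc k * + A    ≡⟨ cong (λ u → u + + B + - + suc k * + A) (pos-* (suc k) A) ⟩
    + suc k * + A + + B + - + suc k * + A      ≡⟨ cancel (+ suc k) (+ A) (+ B) ⟩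
    + B                                        ≡⟨ cong (λ n → + S n k) (ℕ.+-suc N k) ⟩
    + S (suc N ℕ.+ k) k                        ∎
    where
    open ≡-Reasoning
    A = S (N ℕ.+ suc k) (suc k)
    B = S (N ℕ.+ suc k) k
    cancel : ∀ c a y → c * a + y + - c * a ≡ y
    cancel = solve-∀

  ∏[1-ix]-stirlingSeries : ∀ k → ⟦ ∏[1-ix] k ⟧ (stirlingSeries k) ≗ δ
  ∏[1-ix]-stirlingSeries zero    zero    = refl
  ∏[1-ix]-stirlingSeries zero    (suc n) = refl
  ∏[1-ix]-stirlingSeries (suc k) n       =
    trans (⟦⟧-comm (1- + suc k ·x) (∏[1-ix] k) (stirlingSeries (suc k)) n)
      (trans (⟦⟧-cong (∏[1-ix] k) (1-·x-stirlingSeries k) n) (∏[1-ix]-stirlingSeries k n))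

  -- spread f is f(x²).
  spread : Series → Series
  spread f zero          = f zero
  spread f (suc zero)    = 0ℤ
  spread f (suc (suc n)) = spread (f ∘ suc) n

  spread-δ : spread δ ≗ δ
  spread-δ zero          = refl
  spread-δ (suc zero)    = refl
  spread-δ (suc (suc n)) = spread-0 n
    where
    spread-0 : spread (λ _ → 0ℤ) ≗ λ _ → 0ℤ
    spread-0 zero          = refl
    spread-0 (suc zero)    = refl
    spread-0 (suc (suc n)) = spread-0 n

  1-x : Op
  1-x = 1- 1ℤ ·x

  ⟦1-x²⟧-spread : ∀ f → ⟦ 1-x² ⟧ (spread f) ≗ spread (⟦ 1-x ⟧ f)
  ⟦1-x²⟧-spread f zero                      = refl
  ⟦1-x²⟧-spread f (suc zero)                = refl
  ⟦1-x²⟧-spread f (suc (suc zero))          = refl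
  ⟦1-x²⟧-spread f (suc (suc (suc zero)))    = refl
  ⟦1-x²⟧-spread f (suc (suc (suc (suc n)))) = ⟦1-x²⟧-spread (f ∘ suc) (suc (suc n))

  ⟦1-x²^ᴼ⟧-spread : ∀ k f → ⟦ 1-x² ^ᴼ k ⟧ (spread f) ≗ spread (⟦ 1-x ^ᴼ k ⟧ f)
  ⟦1-x²^ᴼ⟧-spread zero    f n = refl
  ⟦1-x²^ᴼ⟧-spread (suc k) f n =
    trans (⟦⟧-cong 1-x² (⟦1-x²^ᴼ⟧-spread k f) n) (⟦1-x²⟧-spread (⟦ 1-x ^ᴼ k ⟧ f) n)

  -- binomialSeries H is 1 / (1 - x)^(H + 1).
  binomialSeries : ℕ → Series
  binomialSeries H t = + ((t ℕ.+ H) C H)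

  ⟦1-x⟧-binomialSeries : ∀ H → ⟦ 1-x ⟧ (binomialSeries (suc H)) ≗ binomialSeries H
  ⟦1-x⟧-binomialSeries H zero    =
    trans (+-identityʳ _) (cong +_ (trans (nCn≡1 (suc H)) (sym (nCn≡1 H))))
  ⟦1-x⟧-binomialSeries H (suc t) = begin
    + (suc n C suc H) + -1ℤ * + (n C suc H)
      ≡⟨ cong (λ u → + u + -1ℤ * + (n C suc H)) (sym (nCk+nC[k+1]≡[n+1]C[k+1] n H)) ⟩
    + (n C H ℕ.+ n C suc H) + -1ℤ * + (n C suc H)    ≡⟨ cong (_+ -1ℤ * + (n C suc H)) (pos-+ (n C H) _) ⟩
    + (n C H) + + (n C suc H) + -1ℤ * + (n C suc H)  ≡⟨ cancel (+ (n C H)) (+ (n C suc H)) ⟩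
    + (n C H)                                        ≡⟨ cong (λ m → + (m C H)) (ℕ.+-suc t H) ⟩
    + ((suc t ℕ.+ H) C H)                            ∎
    where
    open ≡-Reasoning
    n = t ℕ.+ suc H
    cancel : ∀ x y → x + y + -1ℤ * y ≡ x
    cancel = solve-∀

  ⟦1-x⟧-binomialSeries-0 : ⟦ 1-x ⟧ (binomialSeries 0) ≗ δ
  ⟦1-x⟧-binomialSeries-0 zero    = refl
  ⟦1-x⟧-binomialSeries-0 (suc t) = refl

  ⟦1-x^ᴼ⟧-binomialSeries : ∀ H → ⟦ 1-x ^ᴼ suc H ⟧ (binomialSeries H) ≗ δ
  ⟦1-x^ᴼ⟧-binomialSeries zero    n = ⟦1-x⟧-binomialSeries-0 n
  ⟦1-x^ᴼ⟧-binomialSeries (suc H) n =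
    trans (⟦⟧-comm 1-x (1-x ^ᴼ suc H) (binomialSeries (suc H)) n)
      (trans (⟦⟧-cong (1-x ^ᴼ suc H) (⟦1-x⟧-binomialSeries H) n) (⟦1-x^ᴼ⟧-binomialSeries H n))

  spread-cong : ∀ {f g} → f ≗ g → spread f ≗ spread g
  spread-cong f≗g zero          = f≗g zero
  spread-cong f≗g (suc zero)    = refl
  spread-cong f≗g (suc (suc n)) = spread-cong (f≗g ∘ suc) n

  ⟦1-x²^ᴼ⟧-spread-binomialSeries : ∀ H → ⟦ 1-x² ^ᴼ suc H ⟧ (spread (binomialSeries H)) ≗ δ
  ⟦1-x²^ᴼ⟧-spread-binomialSeries H n =
    trans (⟦1-x²^ᴼ⟧-spread (suc H) (binomialSeries H) n)
      (trans (spread-cong (⟦1-x^ᴼ⟧-binomialSeries H) n) (spread-δ n))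

  -- f n - g n is the difference of (1 - x²) f and (1 - x²) g at n plus that of f and g at n - 2.
  ⟦1-x²⟧-cancel : ∀ {M f g} → ⟦ 1-x² ⟧ f ≈[ M ] ⟦ 1-x² ⟧ g → f ≈[ M ] g
  ⟦1-x²⟧-cancel {M} {f} {g} [1-x²]f≈g = mk≈ λ n → proj₁ (consecutive n)
    where
    step : ∀ n → M ∣ shift (shift f) n - shift (shift g) n → M ∣ f n - g n
    step n M∣ = subst (M ∣_) (telescope (f n) (g n) (shift (shift f) n) (shift (shift g) n))
      (∣m∣n⇒∣m+n (at [1-x²]f≈g n) M∣)
      where
      telescope : ∀ x y u v → x + -1ℤ * u - (y + -1ℤ * v) + (u - v) ≡ x - y
      telescope = solve-∀
    consecutive : ∀ n → M ∣ f n - g n × M ∣ f (suc n) - g (suc n)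
    consecutive zero    = step 0 (divides 0ℤ refl) , step 1 (divides 0ℤ refl)
    consecutive (suc n) = proj₂ (consecutive n) , step (suc (suc n)) (proj₁ (consecutive n))

  ⟦1-x²^ᴼ⟧-cancel : ∀ k {M f g} → ⟦ 1-x² ^ᴼ k ⟧ f ≈[ M ] ⟦ 1-x² ^ᴼ k ⟧ g → f ≈[ M ] g
  ⟦1-x²^ᴼ⟧-cancel zero    f≈g = mk≈ (at f≈g)
  ⟦1-x²^ᴼ⟧-cancel (suc k) f≈g = ⟦1-x²^ᴼ⟧-cancel k (⟦1-x²⟧-cancel f≈g)

  spread-even : ∀ f t → spread f (t ℕ.* 2) ≡ f t
  spread-even f zero    = refl
  spread-even f (suc t) = spread-even (f ∘ suc) t

  spread-odd : ∀ f t → spread f (suc (t ℕ.* 2)) ≡ 0ℤ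
  spread-odd f zero    = refl
  spread-odd f (suc t) = spread-odd (f ∘ suc) t

  shift-spread-even : ∀ f t → shift (spread f) (t ℕ.* 2) ≡ 0ℤ
  shift-spread-even f zero    = refl
  shift-spread-even f (suc t) = spread-odd f t

  ⟦1+·[x+x²]⟧-at : ∀ c g n {u v w} → g n ≡ u → shift g n ≡ v → shift (shift g) n ≡ w →
                   ⟦ 1+ c ·[x+x²] ⟧ g n ≡ u + c * (v + w)
  ⟦1+·[x+x²]⟧-at c g n refl refl refl = refl

  ⟦1+·[x+x²]⟧-spread-odd : ∀ c f t → ⟦ 1+ c ·[x+x²] ⟧ (spread f) (suc (t ℕ.* 2)) ≡ c * f t
  ⟦1+·[x+x²]⟧-spread-odd c f t =
    trans (⟦1+·[x+x²]⟧-at c (spread f) (suc (t ℕ.* 2)) (spread-odd f t) (spread-even f t) (shift-spread-even f t))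
      (simplify c (f t))
    where
    simplify : ∀ c y → 0ℤ + c * (y + 0ℤ) ≡ c * y
    simplify = solve-∀

  ⟦1+·[x+x²]⟧-spread-even : ∀ c f t → ⟦ 1+ c ·[x+x²] ⟧ (spread f) (suc t ℕ.* 2) ≡ f (suc t) + c * f t
  ⟦1+·[x+x²]⟧-spread-even c f t =
    trans (⟦1+·[x+x²]⟧-at c (spread f) (suc t ℕ.* 2) (spread-even (f ∘ suc) t) (spread-odd f t) (spread-even f t))
      (simplify (f (suc t)) c (f t))
    where
    simplify : ∀ x c y → x + c * (0ℤ + y) ≡ x + c * y
    simplify = solve-∀

  1+·[x+x²]-involutive : ∀ {M} c → M ∣ c * c → M ∣ c + c → 1+ c ·[x+x²] ⊗ 1+ c ·[x+x²] ≈ᴼ[ M ] I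
  1+·[x+x²]-involutive {M} c M∣c² M∣2c = begin
    1+ c ·[x+x²] ⊗ 1+ c ·[x+x²]   ≈⟨ 1+·[x+x²]-⊗ c c M∣c² ⟩
    1+ c + c ·[x+x²]              ≈⟨ 1+·[x+x²]-cong (subst (M ∣_) (sym (+-identityʳ (c + c))) M∣2c) ⟩
    1+ 0ℤ ·[x+x²]                 ≈⟨ 1+0·[x+x²] ⟩
    I                             ∎
    where open ≈ᴼ-Reasoning M

  Q-inverse : ∀ {M} H c g → 1 ℕ.≤ H → M ∣ c * c → M ∣ c + c → ⟦ Q H c ⟧ g ≈[ M ] δ →
              g ≈[ M ] ⟦ 1+ c ·[x+x²] ⟧ (spread (binomialSeries (H ℕ.∸ 1)))
  Q-inverse {M} (suc H) c g _ M∣c² M∣2c Qg≈δ = ⟦1-x²^ᴼ⟧-cancel (suc H) (begin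
    ⟦ E ⟧ g                  ≈⟨ apply (1+·[x+x²]-involutive c M∣c² M∣2c) (⟦ E ⟧ g) ⟨
    ⟦ W ⟧ (⟦ W ⟧ (⟦ E ⟧ g))  ≈⟨ ⟦⟧-≈ W (≗⇒≈ (⟦⟧-comm W E g)) ⟩
    ⟦ W ⟧ (⟦ Q (suc H) c ⟧ g) ≈⟨ ⟦⟧-≈ W Qg≈δ ⟩
    ⟦ W ⟧ δ                  ≈⟨ ≗⇒≈ E[WB]≗Wδ ⟨
    ⟦ E ⟧ (⟦ W ⟧ B)          ∎)
    where
    open ≈-Reasoning M
    E = 1-x² ^ᴼ suc H
    W = 1+ c ·[x+x²]
    B = spread (binomialSeries H)
    E[WB]≗Wδ : ⟦ E ⟧ (⟦ W ⟧ B) ≗ ⟦ W ⟧ δ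
    E[WB]≗Wδ n = trans (⟦⟧-comm E W B n) (⟦⟧-cong W (⟦1-x²^ᴼ⟧-spread-binomialSeries H) n)

  1≤[1+a]*2^ : ∀ a′ j → 1 ℕ.≤ suc a′ ℕ.* 2 ℕ.^ j
  1≤[1+a]*2^ a′ j = ℕ.≤-trans (ℕ.m^n>0 2 j) (ℕ.m≤m+n (2 ℕ.^ j) (a′ ℕ.* 2 ℕ.^ j))

  1+[n∸1]≡n : ∀ {n} → 1 ℕ.≤ n → suc (n ℕ.∸ 1) ≡ n
  1+[n∸1]≡n (ℕ.s≤s ℕ.z≤n) = refl

  ∏[1-ix]-2^-multiple : ∀ k a′ → let a = suc a′; M = 2 ℕ.^ (3 ℕ.+ k) in
    ∏[1-ix] (a ℕ.* M ℕ.∸ 1) ≈ᴼ[ + M ] Q (a ℕ.* 2 ℕ.^ (1 ℕ.+ k)) (+ (a ℕ.* 2 ℕ.^ (2 ℕ.+ k)))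
  ∏[1-ix]-2^-multiple k a′ = begin
    ∏[1-ix] K                   ≈⟨ ∏[1-ix]-drop-last (pos-∣ a 1+K≡aM) ⟨
    ∏[1-ix] (suc K)             ≈⟨ ≡⇒≈ᴼ (cong ∏[1-ix] 1+K≡aM) ⟩
    ∏[1-ix] (a ℕ.* M)           ≈⟨ ∏[1-ix]-multiple a M ⟩
    ∏[1-ix] M ^ᴼ a              ≈⟨ prod-cong (λ _ → ∏[1-ix]-2^ k) a ⟩
    Q e (+ c) ^ᴼ a              ≈⟨ Q-^ᴼ e (+ c) M∣c*c a ⟩
    Q (a ℕ.* e) (+ a * + c)     ≈⟨ ≡⇒≈ᴼ (cong (Q (a ℕ.* e)) (sym (pos-* a c))) ⟩
    Q (a ℕ.* e) (+ (a ℕ.* c))   ∎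
    where
    a = suc a′
    p = 2 ℕ.^ k
    e = 2 ℕ.^ (1 ℕ.+ k)
    c = 2 ℕ.^ (2 ℕ.+ k)
    M = 2 ℕ.^ (3 ℕ.+ k)
    K = a ℕ.* M ℕ.∸ 1
    open ≈ᴼ-Reasoning (+ M)
    1+K≡aM : suc K ≡ a ℕ.* M
    1+K≡aM = 1+[n∸1]≡n (1≤[1+a]*2^ a′ (3 ℕ.+ k))
    M∣c*c : + M ∣ + c * + c
    M∣c*c = subst (+ M ∣_) (pos-* c c) (pos-∣ (2 ℕ.* p) (square p))
      where
      square : ∀ p → 2 ℕ.* (2 ℕ.* p) ℕ.* (2 ℕ.* (2 ℕ.* p)) ≡ 2 ℕ.* p ℕ.* (2 ℕ.* (2 ℕ.* (2 ℕ.* p)))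
      square = ℕ-solve-∀

  stirlingSeries-≈ : ∀ k a′ →
    let a = suc a′; H = a ℕ.* 2 ℕ.^ (1 ℕ.+ k); coeff = a ℕ.* 2 ℕ.^ (2 ℕ.+ k); M = 2 ℕ.^ (3 ℕ.+ k) in
    stirlingSeries (a ℕ.* M ℕ.∸ 1) ≈[ + M ] ⟦ 1+ + coeff ·[x+x²] ⟧ (spread (binomialSeries (H ℕ.∸ 1)))
  stirlingSeries-≈ k a′ = Q-inverse H (+ coeff) (stirlingSeries K) (1≤[1+a]*2^ a′ (1 ℕ.+ k)) M∣coeff² M∣2coeff
    (≈-trans (≈-sym (apply (∏[1-ix]-2^-multiple k a′) (stirlingSeries K))) (≗⇒≈ (∏[1-ix]-stirlingSeries K)))
    where
    a = suc a′
    p = 2 ℕ.^ k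
    M = 2 ℕ.^ (3 ℕ.+ k)
    H = a ℕ.* 2 ℕ.^ (1 ℕ.+ k)
    coeff = a ℕ.* 2 ℕ.^ (2 ℕ.+ k)
    K = a ℕ.* M ℕ.∸ 1
    M∣coeff² : + M ∣ + coeff * + coeff
    M∣coeff² = subst (+ M ∣_) (pos-* coeff coeff) (pos-∣ (a ℕ.* a ℕ.* (2 ℕ.* p)) (square a p))
      where
      square : ∀ a p → a ℕ.* (2 ℕ.* (2 ℕ.* p)) ℕ.* (a ℕ.* (2 ℕ.* (2 ℕ.* p)))
                     ≡ a ℕ.* a ℕ.* (2 ℕ.* p) ℕ.* (2 ℕ.* (2 ℕ.* (2 ℕ.* p)))
      square = ℕ-solve-∀
    M∣2coeff : + M ∣ + coeff + + coeff
    M∣2coeff = subst (+ M ∣_) (pos-+ coeff coeff) (pos-∣ a (twice a p))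
      where
      twice : ∀ a p → a ℕ.* (2 ℕ.* (2 ℕ.* p)) ℕ.+ a ℕ.* (2 ℕ.* (2 ℕ.* p))
                    ≡ a ℕ.* (2 ℕ.* (2 ℕ.* (2 ℕ.* p)))
      twice = ℕ-solve-∀

open import Defs
open import Data.Nat using (ℕ; zero; suc; _+_; _*_; _∸_; _^_; _≤_; _/_; s≤s; z≤n)
open import Data.Nat.Combinatorics using (_C_)
open import Data.Nat.Divisibility using (_∣_; divides)
open import Data.Nat.DivMod using (m*n/n≡m)
open import Data.Nat.Properties
  using (+-suc; +-comm; *-comm; m+n∸m≡n; *-cancelʳ-≤; *-cancelʳ-<; m<1+n⇒m≤n; m≤n⇒∃[o]m+o≡n)
open import Data.Nat.Tactic.RingSolver using (solve-∀)
import Data.Integer as ℤ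
import Data.Integer.Divisibility.Signed as ℤ
import Data.Integer.Properties as ℤ
open import Data.Product using (∃; _×_; _,_)
open import Data.Sum using (_⊎_; inj₁; inj₂)
open import Relation.Nullary using (¬_; contradiction)
open import Relation.Binary.PropositionalEquality
  using (_≡_; refl; sym; trans; cong; cong₂; subst; module ≡-Reasoning)
open PowerSeries

even⊎odd : ∀ n → (∃ λ q → n ≡ q * 2) ⊎ (∃ λ q → n ≡ suc (q * 2))
even⊎odd zero    = inj₁ (0 , refl)
even⊎odd (suc n) with even⊎odd n
... | inj₁ (q , refl) = inj₂ (q , refl)
... | inj₂ (q , refl) = inj₁ (suc q , refl)

≈-coefficient : ∀ {M f g} → f ≈[ ℤ.+ M ] g →
                ∀ N {x y} → f N ≡ ℤ.+ x → g N ≡ ℤ.+ y → x ≡ y [mod M ]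
≈-coefficient {M} f≈g N fN≡x gN≡y =
  ℤ.∣⇒∣ᵤ (subst (ℤ.+ M ℤ.∣_) (cong₂ ℤ._-_ fN≡x gN≡y) (at f≈g N))

pos-linear : ∀ c x y → ℤ.+ y ℤ.+ ℤ.+ c ℤ.* ℤ.+ x ≡ ℤ.+ (c * x + y)
pos-linear c x y = trans (ℤ.+-comm (ℤ.+ y) (ℤ.+ c ℤ.* ℤ.+ x))
  (trans (cong (ℤ._+ ℤ.+ y) (sym (ℤ.pos-* c x))) (sym (ℤ.pos-+ (c * x) y)))

[2h+t]*2≡1+2t+K : ∀ {K} h t → suc K ≡ 2 * (2 * h) → (2 * h + t) * 2 ≡ suc (t * 2 + K)
[2h+t]*2≡1+2t+K {K} h t 1+K≡4h = begin
  (2 * h + t) * 2       ≡⟨ rearrange h t ⟩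
  t * 2 + 2 * (2 * h)   ≡⟨ cong (t * 2 +_) (sym 1+K≡4h) ⟩
  t * 2 + suc K         ≡⟨ +-suc (t * 2) K ⟩
  suc (t * 2 + K)       ∎
  where
  open ≡-Reasoning
  rearrange : ∀ h t → (2 * h + t) * 2 ≡ t * 2 + 2 * (2 * h)
  rearrange = solve-∀

[2h+t]∸h≡h+t : ∀ h t → 2 * h + t ∸ h ≡ h + t
[2h+t]∸h≡h+t h t = trans (cong (_∸ h) (regroup h t)) (m+n∸m≡n h (h + t))
  where
  regroup : ∀ h t → 2 * h + t ≡ h + (h + t)
  regroup = solve-∀

1+[2h+t]∸h≡1+h+t : ∀ h t → suc (2 * h + t) ∸ h ≡ suc (h + t)
1+[2h+t]∸h≡1+h+t h t = trans (cong (_∸ h) (regroup h t)) (m+n∸m≡n h (suc (h + t)))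
  where
  regroup : ∀ h t → suc (2 * h + t) ≡ h + suc (h + t)
  regroup = solve-∀

half-≤-even : ∀ {h q} → 2 * h ≤ q * 2 → h ≤ q
half-≤-even {h} {q} 2h≤2q = *-cancelʳ-≤ h q 2 (subst (_≤ q * 2) (*-comm 2 h) 2h≤2q)

half-≤-odd : ∀ {h q} → 2 * h ≤ suc (q * 2) → h ≤ q
half-≤-odd {h} {q} 2h≤1+2q =
  m<1+n⇒m≤n (*-cancelʳ-< 2 h (suc q) (s≤s (subst (_≤ suc (q * 2)) (*-comm 2 h) 2h≤1+2q)))

[h+t]∸1≡t+[h∸1] : ∀ {h} t → 1 ≤ h → h + t ∸ 1 ≡ t + (h ∸ 1)
[h+t]∸1≡t+[h∸1] {suc h′} t _ = +-comm h′ t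

h+t≡1+t+[h∸1] : ∀ {h} t → 1 ≤ h → h + t ≡ suc t + (h ∸ 1)
h+t≡1+t+[h∸1] {suc h′} t _ = cong suc (+-comm h′ t)

module _ (k a′ : ℕ) where
  private
    a = suc a′
    p = 2 ^ k
    M = 2 ^ (3 + k)
    H = a * 2 ^ (1 + k)
    coeff = a * 2 ^ (2 + k)
    K = a * M ∸ 1
    B = binomialSeries (H ∸ 1)

    aM≡4H : a * M ≡ 2 * (2 * H)
    aM≡4H = rearrange a p
      where
      rearrange : ∀ a p → a * (2 * (2 * (2 * p))) ≡ 2 * (2 * (a * (2 * p)))
      rearrange = solve-∀
    1+K≡4H : suc K ≡ 2 * (2 * H)
    1+K≡4H = trans (1+[n∸1]≡n (1≤[1+a]*2^ a′ (3 + k))) aM≡4H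
    1≤H : 1 ≤ H
    1≤H = 1≤[1+a]*2^ a′ (1 + k)

  stirling-even : ∀ n → a * M ≤ n → 2 ∣ n → S n K ≡ coeff * ((n / 2 ∸ H ∸ 1) C (H ∸ 1)) [mod M ]
  stirling-even .(q * 2) aM≤n (divides q refl)
    with m≤n⇒∃[o]m+o≡n {2 * H} {q} (half-≤-even (subst (_≤ q * 2) aM≡4H aM≤n))
  ... | t , refl = ≈-coefficient (stirlingSeries-≈ k a′) (suc (t * 2))
    (cong (λ x → ℤ.+ S x K) (sym ([2h+t]*2≡1+2t+K H t 1+K≡4H)))
    (trans (⟦1+·[x+x²]⟧-spread-odd (ℤ.+ coeff) B t)
      (trans (sym (ℤ.pos-* coeff _)) (cong (λ x → ℤ.+ (coeff * (x C (H ∸ 1)))) (sym index))))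
    where
    index : (2 * H + t) * 2 / 2 ∸ H ∸ 1 ≡ t + (H ∸ 1)
    index = trans (cong (λ x → x ∸ H ∸ 1) (m*n/n≡m (2 * H + t) 2))
              (trans (cong (_∸ 1) ([2h+t]∸h≡h+t H t)) ([h+t]∸1≡t+[h∸1] t 1≤H))

  stirling-odd : ∀ n → a * M ≤ n → ¬ (2 ∣ n) →
    S n K ≡ coeff * (((n + 1) / 2 ∸ H ∸ 2) C (H ∸ 1)) + (((n + 1) / 2 ∸ H ∸ 1) C (H ∸ 1)) [mod M ]
  stirling-odd n aM≤n 2∤n with even⊎odd n
  ... | inj₁ (q , n≡2q) = contradiction (divides q n≡2q) 2∤n
  ... | inj₂ (q , refl)
    with m≤n⇒∃[o]m+o≡n {2 * H} {q} (half-≤-odd (subst (_≤ suc (q * 2)) aM≡4H aM≤n))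
  ... | t , refl = ≈-coefficient (stirlingSeries-≈ k a′) (suc t * 2)
    (cong (λ x → ℤ.+ S (suc x) K) (sym ([2h+t]*2≡1+2t+K H t 1+K≡4H)))
    (trans (⟦1+·[x+x²]⟧-spread-even (ℤ.+ coeff) B t)
      (trans (pos-linear coeff ((t + (H ∸ 1)) C (H ∸ 1)) ((suc t + (H ∸ 1)) C (H ∸ 1)))
        (cong₂ (λ x y → ℤ.+ (coeff * (x C (H ∸ 1)) + y C (H ∸ 1))) (sym index₂) (sym index₁))))
    where
    half : (suc ((2 * H + t) * 2) + 1) / 2 ≡ suc (2 * H + t)
    half = trans (cong (_/ 2) (+-comm (suc ((2 * H + t) * 2)) 1)) (m*n/n≡m (suc (2 * H + t)) 2)
    index₁ : (suc ((2 * H + t) * 2) + 1) / 2 ∸ H ∸ 1 ≡ suc t + (H ∸ 1)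
    index₁ = trans (cong (λ x → x ∸ H ∸ 1) half)
               (trans (cong (_∸ 1) (1+[2h+t]∸h≡1+h+t H t)) (h+t≡1+t+[h∸1] t 1≤H))
    index₂ : (suc ((2 * H + t) * 2) + 1) / 2 ∸ H ∸ 2 ≡ t + (H ∸ 1)
    index₂ = trans (cong (λ x → x ∸ H ∸ 2) half)
               (trans (cong (_∸ 2) (1+[2h+t]∸h≡1+h+t H t)) ([h+t]∸1≡t+[h∸1] t 1≤H))

lemma2p5 : (a n m : ℕ) → 1 ≤ a → 3 ≤ m → a * 2 ^ m ≤ n →
    (2 ∣ n → S n (a * 2 ^ m ∸ 1)
        ≡ (a * 2 ^ (m ∸ 1) * ((n / 2 ∸ a * 2 ^ (m ∸ 2) ∸ 1) C (a * 2 ^ (m ∸ 2) ∸ 1))) [mod 2 ^ m ])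
    × (¬ (2 ∣ n) → S n (a * 2 ^ m ∸ 1)
        ≡ (a * 2 ^ (m ∸ 1) * (((n + 1) / 2 ∸ a * 2 ^ (m ∸ 2) ∸ 2) C (a * 2 ^ (m ∸ 2) ∸ 1))
           + (((n + 1) / 2 ∸ a * 2 ^ (m ∸ 2) ∸ 1) C (a * 2 ^ (m ∸ 2) ∸ 1))) [mod 2 ^ m ])
lemma2p5 (suc a′) n (suc (suc (suc k))) (s≤s z≤n) (s≤s (s≤s (s≤s z≤n))) aM≤n =
  stirling-even k a′ n aM≤n , stirling-odd k a′ n aM≤n
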